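{- Let $p\equiv 1\pmod 4$ be a prime. (i) For each $a\in V$, letting $b=\overline{a}-a$, we have $b\in V$ and $\overline{b}=\widetilde{\overline{a}+a}$. (ii) $\{\overline{a}-a : a\in V\}=V$ and $\{\widetilde{\overline{a}+a} : a\in V\}=\{1,2,\ldots,(p-1)/2\}\setminus V$.
   Context: For an integer $x$, $\{x\}_p$ denotes the least nonnegative residue of $x$ modulo $p$, and $\widetilde{x}=p-\{x\}_p$ if $\{x\}_p>p/2$, while $\widetilde{x}=\{x\}_p$ if $\{x\}_p<p/2$. Let $t=\prod_{x=1}^{(p-1)/2}x$. Let $V=\{x : 1\le x\le (p-1)/2,\ x<\widetilde{tx}\}$, and for $a\in V$ put $\overline{a}=\widetilde{ta}$. -}

module Defs where

open import Data.Nat using (ℕ; zero; suc; _+_; _*_; _∸_; _≤_; _<_; _<ᵇ_; _!)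
open import Data.Nat.DivMod using (_%_; _/_)

open import Data.Nat.Primality using (Prime)
open import Data.Bool using (if_then_else_)
open import Data.Product using (_×_)

half : ℕ → ℕ
half p = (p ∸ 1) / 2

residue : (p : ℕ) → .{{_ : Data.Nat.NonZero p}} → ℕ → ℕ
residue p x = x % p

-- x̃ : p - {x}_p if {x}_p > p/2, else {x}_p.
-- For odd p, {x}_p > p/2 iff (p-1)/2 < {x}_p.
tilde : (p : ℕ) → .{{_ : Data.Nat.NonZero p}} → ℕ → ℕ
tilde p x = if half p <ᵇ residue p x then p ∸ residue p x else residue p x

t : ℕ → ℕ
t p = half p !

InV : (p : ℕ) → .{{_ : Data.Nat.NonZero p}} → ℕ → Set
InV p x = (1 ≤ x × x ≤ half p) × x < tilde p (t p * x)

bar : (p : ℕ) → .{{_ : Data.Nat.NonZero p}} → ℕ → ℕ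
bar p a = tilde p (t p * a)

{-# OPTIONS --safe #-}
-- Let h = (p - 1)/2 and τ = h!. Since h + j ≡ -(h + 1 - j), Wilson's theorem gives
-- (-1)^h τ² ≡ (p - 1)! ≡ -1, and h is even, so τ² ≡ -1 (mod p). As ā is the representative
-- in [1, h] of ±τa, bar is an involution of [1, h] without fixed points, and it exchanges V
-- with its complement. If ā ≡ ±τa then τ(ā - a) ≡ ∓(ā + a), which gives (i). Conversely, for
-- b ∈ V pick a ∈ [1, h] with b + 2a ≡ ±b̄ (the sign fixed by the parity of b̄ - b); halving
-- this congruence yields ā = a + b. So a ↦ ā - a maps V onto V, and (ii) follows by applying bar.
module Submission where

open import Algebra.Bundles using (CommutativeMonoid; CommutativeRing)
open import Algebra.Structures using (IsCommutativeRing)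
open import Data.Bool using (Bool; true; false; if_then_else_; T)
open import Data.Bool.Properties using (T-≡)
open import Data.Empty using (⊥-elim)
open import Data.Integer as ℤ using (ℤ; +_; 0ℤ; 1ℤ; -1ℤ; _*_; -_; _-_; _^_; ∣_∣; _%ℕ_; _/ℕ_)
open import Data.Integer.DivMod using (n%ℕd<d; a≡a%ℕn+[a/ℕn]*n)
open import Data.Integer.Divisibility.Signed
  using (_∣_; divides; ∣m∣n⇒∣m+n; ∣m⇒∣-m; ∣n⇒∣m*n; ∣m⇒∣m*n; ∣⇒∣ᵤ; ∣ᵤ⇒∣)
import Data.Integer.Properties as ℤ
open import Data.Integer.Tactic.RingSolver using (solve-∀; solve)
open import Data.List using (_∷_; [])
open import Data.Nat as ℕ using (ℕ; zero; suc; _≤_; _<_; _∸_; _<ᵇ_; _≟_; _%_; _!; NonZero; s≤s)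
open import Data.Nat.Coprimality using (coprime⇒gcd≡1; prime⇒coprime) renaming (sym to Coprime-sym)
open import Data.Nat.Divisibility using (n∣m⇒m%n≡0) renaming (_∣_ to _∣ℕ_)
open import Data.Nat.DivMod using (m<n⇒m%n≡m; m%n<n; m≡m%n+[m/n]*n; m*n/n≡m)
open import Data.Nat.GCD using (gcd; gcd-GCD; module Bézout)
open import Data.Nat.Primality using (Prime; euclidsLemma; prime⇒nonTrivial)
import Data.Nat.Properties as ℕ
import Data.Nat.Tactic.RingSolver as ℕ-Solver
open import Data.Product using (_×_; _,_; proj₁; proj₂; ∃-syntax)
open import Data.Sum as Sum using (_⊎_; inj₁; inj₂; [_,_]′)
open import Defs
open import Function using (_∘_; id)
open import Function.Bundles using (Equivalence; _⇔_; mk⇔)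
open import Level using (0ℓ)
open import Relation.Binary.Definitions using (Reflexive; Symmetric; Transitive)
open import Relation.Binary.PropositionalEquality
  using (_≡_; _≢_; refl; sym; trans; cong; cong₂; subst; subst₂; ≢-sym; module ≡-Reasoning)
import Relation.Binary.Reasoning.Setoid
open import Relation.Binary.Structures using (IsEquivalence)
open import Relation.Nullary using (¬_; does; yes; no; contradiction)
open import Relation.Nullary.Decidable using (dec-true; dec-false)

m<1+n∧m≢n⇒m<n : ∀ {m n} → m < suc n → m ≢ n → m < n
m<1+n∧m≢n⇒m<n m<1+n m≢n = ℕ.≤∧≢⇒< (ℕ.m<1+n⇒m≤n m<1+n) m≢n

_∖_ : (ℕ → Bool) → ℕ → (ℕ → Bool)
(S ∖ x) i = if does (i ≟ x) then false else S i

∖-self : ∀ S x → (S ∖ x) x ≡ false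
∖-self S x rewrite dec-true (x ≟ x) refl = refl

∖-≢ : ∀ S {x i} → i ≢ x → (S ∖ x) i ≡ S i
∖-≢ S {x} {i} i≢x rewrite dec-false (i ≟ x) i≢x = refl

T-∖ : ∀ S {x i} → T ((S ∖ x) i) → T (S i) × i ≢ x
T-∖ S {x} {i} t with i ≟ x
... | yes refl = ⊥-elim (subst T (∖-self S x) t)
... | no i≢x = subst T (∖-≢ S i≢x) t , i≢x

module FiniteProduct {c ℓ} (M : CommutativeMonoid c ℓ) where

  open CommutativeMonoid M
    using (Carrier; _≈_; _∙_; ε; setoid; assoc; ∙-congˡ; ∙-congʳ; identityˡ; commutativeSemigroup)
    renaming (refl to ≈-refl)
  open import Algebra.Properties.CommutativeSemigroup commutativeSemigroup using (x∙yz≈y∙xz)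
  open import Relation.Binary.Reasoning.Setoid setoid

  when : Bool → Carrier → Carrier
  when b x = if b then x else ε

  ∏ : (ℕ → Bool) → (ℕ → Carrier) → ℕ → Carrier
  ∏ S f zero = ε
  ∏ S f (suc n) = when (S n) (f n) ∙ ∏ S f n

  ∏-cong : ∀ {S S′} f n → (∀ {i} → i < n → S i ≡ S′ i) → ∏ S f n ≡ ∏ S′ f n
  ∏-cong f zero S≡S′ = refl
  ∏-cong f (suc n) S≡S′ =
    cong₂ (λ b y → when b (f n) ∙ y) (S≡S′ (ℕ.n<1+n n)) (∏-cong f n (S≡S′ ∘ ℕ.m<n⇒m<1+n))

  ∏-extract : ∀ {S x} f n → T (S x) → x < n → ∏ S f n ≈ f x ∙ ∏ (S ∖ x) f n
  ∏-extract {S} {x} f (suc n) Sx x<1+n with n ≟ x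
  ... | yes refl = begin
    when (S n) (f n) ∙ ∏ S f n  ≡⟨ cong₂ (λ b y → when b (f n) ∙ y) (Equivalence.to T-≡ Sx)
                                          (∏-cong f n (λ i<n → sym (∖-≢ S (ℕ.<⇒≢ i<n)))) ⟩
    f n ∙ ∏ (S ∖ n) f n          ≈⟨ ∙-congˡ (identityˡ _) ⟨
    f n ∙ (ε ∙ ∏ (S ∖ n) f n)    ≡⟨ cong (λ b → f n ∙ (when b (f n) ∙ ∏ (S ∖ n) f n)) (∖-self S n) ⟨
    f n ∙ ∏ (S ∖ n) f (suc n)    ∎
  ... | no n≢x = begin
    when (S n) (f n) ∙ ∏ S f n                ≈⟨ ∙-congˡ (∏-extract f n Sx (m<1+n∧m≢n⇒m<n x<1+n (≢-sym n≢x))) ⟩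
    when (S n) (f n) ∙ (f x ∙ ∏ (S ∖ x) f n)  ≈⟨ x∙yz≈y∙xz _ (f x) _ ⟩
    f x ∙ (when (S n) (f n) ∙ ∏ (S ∖ x) f n)  ≡⟨ cong (λ b → f x ∙ (when b (f n) ∙ ∏ (S ∖ x) f n)) (∖-≢ S n≢x) ⟨
    f x ∙ ∏ (S ∖ x) f (suc n)                 ∎

  record Pairing (ι : ℕ → ℕ) (S : ℕ → Bool) (f : ℕ → Carrier) (n : ℕ) : Set ℓ where
    field
      partner-< : ∀ {i} → i < n → T (S i) → ι i < n
      partner-∈ : ∀ {i} → i < n → T (S i) → T (S (ι i))
      partner-≢ : ∀ {i} → i < n → T (S i) → ι i ≢ i
      involutive : ∀ {i} → i < n → T (S i) → ι (ι i) ≡ i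
      cancel : ∀ {i} → i < n → T (S i) → f i ∙ f (ι i) ≈ ε

  -- The largest selected index n is removed together with its partner ι n < n.
  ∏-pairing : ∀ {ι S f} n → Pairing ι S f n → ∏ S f n ≈ ε
  ∏-pairing zero _ = ≈-refl
  ∏-pairing {ι} {S} {f} (suc n) P with S n in Sn
  ... | false = begin
    ε ∙ ∏ S f n  ≈⟨ identityˡ _ ⟩
    ∏ S f n      ≈⟨ ∏-pairing n shrink ⟩
    ε            ∎
    where
    open Pairing P
    shrink : Pairing ι S f n
    shrink = record
      { partner-< = λ i<n Si → m<1+n∧m≢n⇒m<n (partner-< (ℕ.m<n⇒m<1+n i<n) Si) λ ιi≡n →
          subst T (trans (cong S ιi≡n) Sn) (partner-∈ (ℕ.m<n⇒m<1+n i<n) Si)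
      ; partner-∈ = partner-∈ ∘ ℕ.m<n⇒m<1+n
      ; partner-≢ = partner-≢ ∘ ℕ.m<n⇒m<1+n
      ; involutive = involutive ∘ ℕ.m<n⇒m<1+n
      ; cancel = cancel ∘ ℕ.m<n⇒m<1+n
      }
  ... | true = begin
    f n ∙ ∏ S f n                ≈⟨ ∙-congˡ (∏-extract f n (partner-∈ n<1+n Sn′) j<n) ⟩
    f n ∙ (f j ∙ ∏ (S ∖ j) f n)  ≈⟨ assoc _ _ _ ⟨
    (f n ∙ f j) ∙ ∏ (S ∖ j) f n  ≈⟨ ∙-congʳ (cancel n<1+n Sn′) ⟩
    ε ∙ ∏ (S ∖ j) f n            ≈⟨ identityˡ _ ⟩
    ∏ (S ∖ j) f n                ≈⟨ ∏-pairing n shrink ⟩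
    ε                            ∎
    where
    open Pairing P
    n<1+n = ℕ.n<1+n n
    Sn′ : T (S n)
    Sn′ = Equivalence.from T-≡ Sn
    j = ι n
    j<n : j < n
    j<n = m<1+n∧m≢n⇒m<n (partner-< n<1+n Sn′) (partner-≢ n<1+n Sn′)
    shrink : Pairing ι (S ∖ j) f n
    shrink = record
      { partner-< = λ i<n Si∖j → let Si , i≢j = T-∖ S Si∖j ; i<1+n = ℕ.m<n⇒m<1+n i<n in
          m<1+n∧m≢n⇒m<n (partner-< i<1+n Si) λ ιi≡n →
            i≢j (trans (sym (involutive i<1+n Si)) (cong ι ιi≡n))
      ; partner-∈ = λ i<n Si∖j → let Si , _ = T-∖ S Si∖j ; i<1+n = ℕ.m<n⇒m<1+n i<n in
          subst T (sym (∖-≢ S λ ιi≡j → ℕ.<⇒≢ i<n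
              (trans (sym (involutive i<1+n Si)) (trans (cong ι ιi≡j) (involutive n<1+n Sn′)))))
            (partner-∈ i<1+n Si)
      ; partner-≢ = λ i<n Si∖j → partner-≢ (ℕ.m<n⇒m<1+n i<n) (proj₁ (T-∖ S Si∖j))
      ; involutive = λ i<n Si∖j → involutive (ℕ.m<n⇒m<1+n i<n) (proj₁ (T-∖ S Si∖j))
      ; cancel = λ i<n Si∖j → cancel (ℕ.m<n⇒m<1+n i<n) (proj₁ (T-∖ S Si∖j))
      }

[+m]-[+n]≡+[m∸n] : ∀ {m n} → n ≤ m → + m - + n ≡ + (m ∸ n)
[+m]-[+n]≡+[m∸n] {m} {n} n≤m = trans (ℤ.m-n≡m⊖n m n) (ℤ.⊖-≥ n≤m)

-- Congruence modulo p is an equality on ℤ itself, so ℤ/pℤ is ℤ with a coarser setoid equality.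
module Congruence (p : ℕ) where

  open import Data.Integer using (_+_)

  [m+n]-m≡n : ∀ m n → (m + n) - m ≡ n
  [m+n]-m≡n = solve-∀

  pos-+-* : ∀ a b c → + (a ℕ.+ b ℕ.* c) ≡ + a + + b * + c
  pos-+-* a b c = trans (ℤ.pos-+ a (b ℕ.* c)) (cong (λ z → + a + z) (ℤ.pos-* b c))

  infix 4 _≈_ _≈±_

  record _≈_ (x y : ℤ) : Set where
    constructor mod
    field divides-difference : + p ∣ x - y
  open _≈_

  ≈-by : ∀ {x y} z → z ≡ x - y → + p ∣ z → x ≈ y
  ≈-by z eq p∣z = mod (subst (+ p ∣_) eq p∣z)

  ≈-reflexive : ∀ {x y} → x ≡ y → x ≈ y
  ≈-reflexive {x} refl = ≈-by 0ℤ (sym (ℤ.+-inverseʳ x)) (divides 0ℤ refl)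

  ≈-refl : Reflexive _≈_
  ≈-refl = ≈-reflexive refl

  ≈-sym : Symmetric _≈_
  ≈-sym {x} {y} (mod d) = ≈-by (- (x - y)) (solve (x ∷ y ∷ [])) (∣m⇒∣-m d)

  ≈-trans : Transitive _≈_
  ≈-trans {x} {y} {z} (mod d) (mod e) = ≈-by _ (ℤ.+-minus-telescope x y z) (∣m∣n⇒∣m+n d e)

  +-cong : ∀ {x y u v} → x ≈ y → u ≈ v → x + u ≈ y + v
  +-cong {x} {y} {u} {v} (mod d) (mod e) =
    ≈-by ((x - y) + (u - v)) (solve (x ∷ y ∷ u ∷ v ∷ [])) (∣m∣n⇒∣m+n d e)

  *-cong : ∀ {x y u v} → x ≈ y → u ≈ v → x * u ≈ y * v
  *-cong {x} {y} {u} {v} (mod d) (mod e) =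
    ≈-by ((x - y) * u + y * (u - v)) (solve (x ∷ y ∷ u ∷ v ∷ []))
      (∣m∣n⇒∣m+n (∣m⇒∣m*n u d) (∣n⇒∣m*n y e))

  -‿cong : ∀ {x y} → x ≈ y → - x ≈ - y
  -‿cong {x} {y} (mod d) = ≈-by (- (x - y)) (solve (x ∷ y ∷ [])) (∣m⇒∣-m d)

  ≈-isEquivalence : IsEquivalence _≈_
  ≈-isEquivalence = record { refl = ≈-refl ; sym = ≈-sym ; trans = ≈-trans }

  isCommutativeRing : IsCommutativeRing _≈_ _+_ _*_ -_ 0ℤ 1ℤ
  isCommutativeRing = record
    { isRing = record
      { +-isAbelianGroup = record
        { isGroup = record
          { isMonoid = record
            { isSemigroup = record
              { isMagma = record { isEquivalence = ≈-isEquivalence ; ∙-cong = +-cong }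
              ; assoc = λ x y z → ≈-reflexive (ℤ.+-assoc x y z)
              }
            ; identity = (≈-reflexive ∘ ℤ.+-identityˡ) , (≈-reflexive ∘ ℤ.+-identityʳ)
            }
          ; inverse = (≈-reflexive ∘ ℤ.+-inverseˡ) , (≈-reflexive ∘ ℤ.+-inverseʳ)
          ; ⁻¹-cong = -‿cong
          }
        ; comm = λ x y → ≈-reflexive (ℤ.+-comm x y)
        }
      ; *-cong = *-cong
      ; *-assoc = λ x y z → ≈-reflexive (ℤ.*-assoc x y z)
      ; *-identity = (≈-reflexive ∘ ℤ.*-identityˡ) , (≈-reflexive ∘ ℤ.*-identityʳ)
      ; distrib = (λ x y z → ≈-reflexive (ℤ.*-distribˡ-+ x y z))
                , (λ x y z → ≈-reflexive (ℤ.*-distribʳ-+ x y z))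
      }
    ; *-comm = λ x y → ≈-reflexive (ℤ.*-comm x y)
    }

  ℤ/pℤ : CommutativeRing 0ℓ 0ℓ
  ℤ/pℤ = record { isCommutativeRing = isCommutativeRing }

  module ≈-Reasoning = Relation.Binary.Reasoning.Setoid (CommutativeRing.setoid ℤ/pℤ)

  ≈0⇒∣ : ∀ {x} → x ≈ 0ℤ → + p ∣ x
  ≈0⇒∣ {x} (mod p∣x-0) = subst (+ p ∣_) (ℤ.+-identityʳ x) p∣x-0

  ∣⇒≈0 : ∀ {x} → + p ∣ x → x ≈ 0ℤ
  ∣⇒≈0 {x} p∣x = ≈-by x (sym (ℤ.+-identityʳ x)) p∣x

  m+n≡p⇒m≈-n : ∀ {m n} → m ℕ.+ n ≡ p → + m ≈ - + n
  m+n≡p⇒m≈-n {m} {n} m+n≡p = mod (divides 1ℤ (begin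
    + m - - + n  ≡⟨ cong (λ z → + m + z) (ℤ.neg-involutive (+ n)) ⟩
    + m + + n    ≡⟨ ℤ.pos-+ m n ⟨
    + (m ℕ.+ n)  ≡⟨ cong +_ m+n≡p ⟩
    + p          ≡⟨ ℤ.*-identityˡ (+ p) ⟨
    1ℤ * + p     ∎))
    where open ≡-Reasoning

  m≈-n⇒m+n≈0 : ∀ {m n} → + m ≈ - + n → + (m ℕ.+ n) ≈ 0ℤ
  m≈-n⇒m+n≈0 {m} {n} m≈-n = begin
    + (m ℕ.+ n)  ≡⟨ ℤ.pos-+ m n ⟩
    + m + + n    ≈⟨ +-cong m≈-n (≈-refl {+ n}) ⟩
    - + n + + n  ≡⟨ ℤ.+-inverseˡ (+ n) ⟩
    0ℤ           ∎
    where open ≈-Reasoning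

  _≈±_ : ℤ → ℤ → Set
  x ≈± y = x ≈ y ⊎ x ≈ - y

  ≈±-sym : ∀ {x y} → x ≈± y → y ≈± x
  ≈±-sym (inj₁ x≈y) = inj₁ (≈-sym x≈y)
  ≈±-sym {x} {y} (inj₂ x≈-y) =
    inj₂ (≈-trans (≈-reflexive (sym (ℤ.neg-involutive y))) (-‿cong (≈-sym x≈-y)))

  ≈±-trans : ∀ {x y z} → x ≈± y → y ≈± z → x ≈± z
  ≈±-trans (inj₁ x≈y) (inj₁ y≈z) = inj₁ (≈-trans x≈y y≈z)
  ≈±-trans (inj₁ x≈y) (inj₂ y≈-z) = inj₂ (≈-trans x≈y y≈-z)
  ≈±-trans (inj₂ x≈-y) (inj₁ y≈z) = inj₂ (≈-trans x≈-y (-‿cong y≈z))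
  ≈±-trans {z = z} (inj₂ x≈-y) (inj₂ y≈-z) =
    inj₁ (≈-trans x≈-y (≈-trans (-‿cong y≈-z) (≈-reflexive (ℤ.neg-involutive z))))

  ≈±-*-congˡ : ∀ z {x y} → x ≈± y → z * x ≈± z * y
  ≈±-*-congˡ z (inj₁ x≈y) = inj₁ (*-cong (≈-refl {z}) x≈y)
  ≈±-*-congˡ z {y = y} (inj₂ x≈-y) =
    inj₂ (≈-trans (*-cong (≈-refl {z}) x≈-y) (≈-reflexive (sym (ℤ.neg-distribʳ-* z y))))

  module _ (u : ℤ) (u²≈-1 : u * u ≈ -1ℤ) where

    open ≈-Reasoning

    *-difference : ∀ {x y} → y ≈± u * x → u * (y - x) ≈± y + x
    *-difference {x} {y} (inj₁ y≈ux) = inj₂ (begin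
      u * (y - x)          ≈⟨ *-cong (≈-refl {u}) (+-cong y≈ux (≈-refl { - x})) ⟩
      u * (u * x - x)      ≡⟨ solve (u ∷ x ∷ []) ⟩
      (u * u) * x - u * x  ≈⟨ +-cong (*-cong u²≈-1 (≈-refl {x})) (≈-refl { - (u * x)}) ⟩
      -1ℤ * x - u * x      ≡⟨ solve (u ∷ x ∷ []) ⟩
      - (u * x + x)        ≈⟨ -‿cong (+-cong (≈-sym y≈ux) (≈-refl {x})) ⟩
      - (y + x)            ∎)
    *-difference {x} {y} (inj₂ y≈-ux) = inj₁ (begin
      u * (y - x)              ≈⟨ *-cong (≈-refl {u}) (+-cong y≈-ux (≈-refl { - x})) ⟩
      u * (- (u * x) - x)      ≡⟨ solve (u ∷ x ∷ []) ⟩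
      - ((u * u) * x) - u * x  ≈⟨ +-cong (-‿cong (*-cong u²≈-1 (≈-refl {x}))) (≈-refl { - (u * x)}) ⟩
      - (-1ℤ * x) - u * x      ≡⟨ solve (u ∷ x ∷ []) ⟩
      - (u * x) + x            ≈⟨ +-cong (≈-sym y≈-ux) (≈-refl {x}) ⟩
      y + x                    ∎)

  module _ .{{_ : NonZero p}} where

    %ℕ-≈ : ∀ z → + (z %ℕ p) ≈ z
    %ℕ-≈ z = ≈-sym (mod (divides q (begin
      z - r              ≡⟨ cong (_- r) (a≡a%ℕn+[a/ℕn]*n z p) ⟩
      (r + q * + p) - r  ≡⟨ [m+n]-m≡n r (q * + p) ⟩
      q * + p            ∎)))
      where
      open ≡-Reasoning
      r = + (z %ℕ p)
      q = z /ℕ p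

    ≈⇒≤ : ∀ {m n} → n ≤ m → m < p → + m ≈ + n → m ≤ n
    ≈⇒≤ {m} {n} n≤m m<p (mod p∣m-n) = ℕ.m∸n≡0⇒m≤n (begin
      m ∸ n        ≡⟨ m<n⇒m%n≡m (ℕ.≤-<-trans (ℕ.m∸n≤m m n) m<p) ⟨
      (m ∸ n) % p  ≡⟨ n∣m⇒m%n≡0 (m ∸ n) p
                        (subst (λ z → p ∣ℕ ∣ z ∣) ([+m]-[+n]≡+[m∸n] n≤m) (∣⇒∣ᵤ p∣m-n)) ⟩
      0            ∎)
      where open ≡-Reasoning

    ≈-injective : ∀ {m n} → m < p → n < p → + m ≈ + n → m ≡ n
    ≈-injective {m} {n} m<p n<p m≈n with ℕ.≤-total n m
    ... | inj₁ n≤m = ℕ.≤-antisym (≈⇒≤ n≤m m<p m≈n) n≤m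
    ... | inj₂ m≤n = ℕ.≤-antisym m≤n (≈⇒≤ m≤n n<p (≈-sym m≈n))

    positive⇒≉0 : ∀ {n} → 0 < n → n < p → ¬ + n ≈ 0ℤ
    positive⇒≉0 0<n n<p n≈0 = ℕ.<⇒≢ 0<n (sym (≈-injective n<p (ℕ.<-trans 0<n n<p) n≈0))

    module PrimeModulus (prime : Prime p) where

      1<p : 1 < p
      1<p = ℕ.nonTrivial⇒n>1 p {{prime⇒nonTrivial prime}}

      x*y≈0⇒x≈0∨y≈0 : ∀ x y → x * y ≈ 0ℤ → x ≈ 0ℤ ⊎ y ≈ 0ℤ
      x*y≈0⇒x≈0∨y≈0 x y xy≈0 = Sum.map (∣⇒≈0 ∘ ∣ᵤ⇒∣) (∣⇒≈0 ∘ ∣ᵤ⇒∣)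
        (euclidsLemma ∣ x ∣ ∣ y ∣ prime (subst (p ∣ℕ_) (ℤ.abs-* x y) (∣⇒∣ᵤ (≈0⇒∣ xy≈0))))

      *-cancelˡ : ∀ z {x y} → ¬ z ≈ 0ℤ → z * x ≈ z * y → x ≈ y
      *-cancelˡ z {x} {y} z≉0 zx≈zy = [ (λ z≈0 → contradiction z≈0 z≉0) , mod ∘ ≈0⇒∣ ]′
        (x*y≈0⇒x≈0∨y≈0 z (x - y) (∣⇒≈0 (subst (+ p ∣_) (factor z x y) (divides-difference zx≈zy))))
        where
        factor : ∀ z x y → z * x - z * y ≡ z * (x - y)
        factor = solve-∀

      x*x≈1⇒x≈1∨x≈-1 : ∀ x → x * x ≈ 1ℤ → x ≈ 1ℤ ⊎ x ≈ -1ℤ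
      x*x≈1⇒x≈1∨x≈-1 x x²≈1 = Sum.map (mod ∘ ≈0⇒∣) (mod ∘ ≈0⇒∣)
        (x*y≈0⇒x≈0∨y≈0 (x - 1ℤ) (x + 1ℤ) (∣⇒≈0 (subst (+ p ∣_) (factor x) (divides-difference x²≈1))))
        where
        factor : ∀ x → x * x - 1ℤ ≡ (x - 1ℤ) * (x + 1ℤ)
        factor = solve-∀

      module _ (u : ℤ) (u²≈-1 : u * u ≈ -1ℤ) (2≉0 : ¬ + 2 ≈ 0ℤ) where

        open ≈-Reasoning

        private
          2ux≡ : ∀ u x y → + 2 * (u * x) ≡ u * (y + (x + x)) - u * y
          2ux≡ = solve-∀
          -y-[y+2x]≡ : ∀ x y → -1ℤ * y - (y + (x + x)) ≡ + 2 * - (x + y)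
          -y-[y+2x]≡ = solve-∀
          y+[y+2x]≡ : ∀ x y → - (-1ℤ * y) - - (y + (x + x)) ≡ + 2 * (x + y)
          y+[y+2x]≡ = solve-∀

        *-halving : ∀ {x y} → y + (x + x) ≈± u * y → x + y ≈± u * x
        *-halving {x} {y} (inj₁ y+2x≈uy) =
          inj₂ (≈-sym (≈-trans (-‿cong ux≈-[x+y]) (≈-reflexive (ℤ.neg-involutive (x + y)))))
          where
          ux≈-[x+y] : u * x ≈ - (x + y)
          ux≈-[x+y] = *-cancelˡ (+ 2) 2≉0 (begin
            + 2 * (u * x)              ≡⟨ 2ux≡ u x y ⟩
            u * (y + (x + x)) - u * y  ≈⟨ +-cong (*-cong (≈-refl {u}) y+2x≈uy) (≈-refl { - (u * y)}) ⟩
            u * (u * y) - u * y        ≡⟨ cong (λ z → z - u * y) (ℤ.*-assoc u u y) ⟨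
            (u * u) * y - u * y        ≈⟨ +-cong (*-cong u²≈-1 (≈-refl {y})) (-‿cong (≈-sym y+2x≈uy)) ⟩
            -1ℤ * y - (y + (x + x))    ≡⟨ -y-[y+2x]≡ x y ⟩
            + 2 * - (x + y)            ∎)
        *-halving {x} {y} (inj₂ y+2x≈-uy) = inj₁ (≈-sym ux≈x+y)
          where
          uy≈-[y+2x] : u * y ≈ - (y + (x + x))
          uy≈-[y+2x] = ≈-trans (≈-reflexive (sym (ℤ.neg-involutive (u * y)))) (-‿cong (≈-sym y+2x≈-uy))
          ux≈x+y : u * x ≈ x + y
          ux≈x+y = *-cancelˡ (+ 2) 2≉0 (begin
            + 2 * (u * x)                  ≡⟨ 2ux≡ u x y ⟩
            u * (y + (x + x)) - u * y      ≈⟨ +-cong (*-cong (≈-refl {u}) y+2x≈-uy) (≈-refl { - (u * y)}) ⟩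
            u * - (u * y) - u * y          ≡⟨ cong (λ z → z - u * y)
                                                (trans (sym (ℤ.neg-distribʳ-* u (u * y))) (cong -_ (sym (ℤ.*-assoc u u y)))) ⟩
            - ((u * u) * y) - u * y        ≈⟨ +-cong (-‿cong (*-cong u²≈-1 (≈-refl {y}))) (-‿cong uy≈-[y+2x]) ⟩
            - (-1ℤ * y) - - (y + (x + x))  ≡⟨ y+[y+2x]≡ x y ⟩
            + 2 * (x + y)                  ∎)

      -- Bézout for gcd y p makes inverse total; it is an inverse only when gcd y p ≡ 1.
      bézout : ∀ y → ∃[ c ] + y * c ≈ + gcd y p
      bézout y with Bézout.identity (gcd-GCD y p)
      ... | Bézout.+- x y′ eq = + x , mod (divides (+ y′) (begin
        + y * + x - + d           ≡⟨ cong (λ z → z - + d) (trans (ℤ.*-comm (+ y) (+ x)) (sym (ℤ.pos-* x y))) ⟩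
        + (x ℕ.* y) - + d         ≡⟨ cong (λ z → + z - + d) eq ⟨
        + (d ℕ.+ y′ ℕ.* p) - + d  ≡⟨ cong (λ z → z - + d) (pos-+-* d y′ p) ⟩
        (+ d + + y′ * + p) - + d  ≡⟨ [m+n]-m≡n (+ d) (+ y′ * + p) ⟩
        + y′ * + p                ∎))
        where
        open ≡-Reasoning
        d = gcd y p
      ... | Bézout.-+ x y′ eq = - + x , mod (divides (- + y′) (begin
        + y * - + x - + d    ≡⟨ rearrange (+ y) (+ x) (+ d) ⟩
        - (+ d + + x * + y)  ≡⟨ cong -_ (pos-+-* d x y) ⟨
        - + (d ℕ.+ x ℕ.* y)  ≡⟨ cong (λ z → - + z) eq ⟩
        - + (y′ ℕ.* p)       ≡⟨ cong -_ (ℤ.pos-* y′ p) ⟩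
        - (+ y′ * + p)       ≡⟨ ℤ.neg-distribˡ-* (+ y′) (+ p) ⟩
        - + y′ * + p         ∎))
        where
        open ≡-Reasoning
        d = gcd y p
        rearrange : ∀ a b c → a * - b - c ≡ - (c + b * a)
        rearrange = solve-∀

      inverse : ℕ → ℕ
      inverse y = proj₁ (bézout y) %ℕ p

      inverse-< : ∀ y → inverse y < p
      inverse-< y = n%ℕd<d (proj₁ (bézout y)) p

      *-inverse : ∀ {y} → 0 < y → y < p → + y * + inverse y ≈ 1ℤ
      *-inverse {y} 0<y y<p = begin
        + y * + inverse y       ≈⟨ *-cong (≈-refl {+ y}) (%ℕ-≈ (proj₁ (bézout y))) ⟩
        + y * proj₁ (bézout y)  ≈⟨ proj₂ (bézout y) ⟩
        + gcd y p               ≡⟨ cong +_ (coprime⇒gcd≡1 (Coprime-sym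
                                     (prime⇒coprime prime {{ℕ.>-nonZero 0<y}} y<p))) ⟩
        1ℤ                      ∎
        where open ≈-Reasoning

      inverse-unique : ∀ {y z} → 0 < y → y < p → z < p → + y * + z ≈ 1ℤ → z ≡ inverse y
      inverse-unique {y} 0<y y<p z<p yz≈1 = ≈-injective z<p (inverse-< y)
        (*-cancelˡ (+ y) (positive⇒≉0 0<y y<p) (≈-trans yz≈1 (≈-sym (*-inverse 0<y y<p))))

      inverse-positive : ∀ {y} → 0 < y → y < p → 0 < inverse y
      inverse-positive {y} 0<y y<p = ℕ.n≢0⇒n>0 λ inverse≡0 → positive⇒≉0 ℕ.z<s 1<p (≈-sym (begin
        0ℤ                 ≡⟨ ℤ.*-zeroʳ (+ y) ⟨
        + y * + 0          ≡⟨ cong (λ z → + y * + z) inverse≡0 ⟨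
        + y * + inverse y  ≈⟨ *-inverse 0<y y<p ⟩
        1ℤ                 ∎))
        where open ≈-Reasoning

      inverse-involutive : ∀ {y} → 0 < y → y < p → inverse (inverse y) ≡ y
      inverse-involutive {y} 0<y y<p = sym (inverse-unique (inverse-positive 0<y y<p) (inverse-< y) y<p
        (≈-trans (≈-reflexive (ℤ.*-comm (+ inverse y) (+ y))) (*-inverse 0<y y<p)))

      open FiniteProduct (CommutativeRing.*-commutativeMonoid ℤ/pℤ) using (∏; Pairing; ∏-pairing)

      ∏-factorial : ∀ m → ∏ (1 <ᵇ_) +_ (suc m) ≡ + (m !)
      ∏-factorial zero = refl
      ∏-factorial (suc zero) = refl
      ∏-factorial (suc (suc m)) =
        trans (cong (+ suc (suc m) *_) (∏-factorial (suc m))) (sym (ℤ.pos-* (suc (suc m)) (suc m !)))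

      module Wilson {m} (p≡2+m : p ≡ suc (suc m)) where

        1+m<p : suc m < p
        1+m<p = subst (suc m <_) (sym p≡2+m) (ℕ.n<1+n (suc m))

        1+m≈-1 : + suc m ≈ -1ℤ
        1+m≈-1 = m+n≡p⇒m≈-n (trans (ℕ.+-comm (suc m) 1) (sym p≡2+m))

        module _ {i} (i<1+m : i < suc m) (selected : T (1 <ᵇ i)) where

          private
            1<i = ℕ.<ᵇ⇒< 1 i selected
            0<i = ℕ.<-trans ℕ.z<s 1<i
            i<p = ℕ.<-trans i<1+m 1+m<p

          i≉1 : ¬ + i ≈ 1ℤ
          i≉1 i≈1 = ℕ.<⇒≢ 1<i (sym (≈-injective i<p 1<p i≈1))

          i≉-1 : ¬ + i ≈ -1ℤ
          i≉-1 i≈-1 = ℕ.<⇒≢ i<1+m (≈-injective i<p 1+m<p (≈-trans i≈-1 (≈-sym 1+m≈-1)))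

          inverse-<-1+m : inverse i < suc m
          inverse-<-1+m = ℕ.≤∧≢⇒< (ℕ.m<1+n⇒m≤n (subst (inverse i <_) p≡2+m (inverse-< i))) λ inverse≡1+m →
            i≉-1 (begin
              + i                    ≡⟨ x≡-[x*-1] (+ i) ⟩
              - (+ i * -1ℤ)          ≈⟨ -‿cong (*-cong (≈-refl {+ i}) 1+m≈-1) ⟨
              - (+ i * + suc m)      ≡⟨ cong (λ z → - (+ i * + z)) inverse≡1+m ⟨
              - (+ i * + inverse i)  ≈⟨ -‿cong (*-inverse 0<i i<p) ⟩
              -1ℤ                    ∎)
            where
            open ≈-Reasoning
            x≡-[x*-1] : ∀ x → x ≡ - (x * -1ℤ)
            x≡-[x*-1] = solve-∀

          inverse-selected : T (1 <ᵇ inverse i)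
          inverse-selected = ℕ.<⇒<ᵇ (ℕ.≤∧≢⇒< (inverse-positive 0<i i<p) λ 1≡inverse → i≉1 (begin
            + i                ≡⟨ ℤ.*-identityʳ (+ i) ⟨
            + i * 1ℤ           ≡⟨ cong (λ z → + i * + z) 1≡inverse ⟩
            + i * + inverse i  ≈⟨ *-inverse 0<i i<p ⟩
            1ℤ                 ∎))
            where open ≈-Reasoning

          inverse≢self : inverse i ≢ i
          inverse≢self inverse≡i = [ i≉1 , i≉-1 ]′
            (x*x≈1⇒x≈1∨x≈-1 (+ i) (subst (λ z → + i * + z ≈ 1ℤ) inverse≡i (*-inverse 0<i i<p)))

          selected-involutive : inverse (inverse i) ≡ i
          selected-involutive = inverse-involutive 0<i i<p

          selected-*-inverse : + i * + inverse i ≈ 1ℤ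
          selected-*-inverse = *-inverse 0<i i<p

        inverse-pairing : Pairing inverse (1 <ᵇ_) +_ (suc m)
        inverse-pairing = record
          { partner-< = inverse-<-1+m
          ; partner-∈ = inverse-selected
          ; partner-≢ = inverse≢self
          ; involutive = selected-involutive
          ; cancel = selected-*-inverse
          }

        -- 2, …, p - 2 pair off with their inverses, leaving (p - 1)! ≈ p - 1.
        wilson : + (suc m !) ≈ -1ℤ
        wilson = begin
          + (suc m !)                     ≡⟨ ℤ.pos-* (suc m) (m !) ⟩
          + suc m * + (m !)               ≡⟨ cong (+ suc m *_) (∏-factorial m) ⟨
          + suc m * ∏ (1 <ᵇ_) +_ (suc m)  ≈⟨ *-cong 1+m≈-1 (∏-pairing (suc m) inverse-pairing) ⟩
          -1ℤ * 1ℤ                        ≡⟨⟩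
          -1ℤ                             ∎
          where open ≈-Reasoning

      wilson : + ((p ∸ 1) !) ≈ -1ℤ
      wilson = subst (λ n → + (n !) ≈ -1ℤ) (cong (_∸ 1) 2+[p∸2]≡p) (Wilson.wilson (sym 2+[p∸2]≡p))
        where
        2+[p∸2]≡p : 2 ℕ.+ (p ∸ 2) ≡ p
        2+[p∸2]≡p = ℕ.m+[n∸m]≡n 1<p

open import Data.Nat using (_+_)

-1^[n+n]≡1 : ∀ n → -1ℤ ^ (n + n) ≡ 1ℤ
-1^[n+n]≡1 zero = refl
-1^[n+n]≡1 (suc n) = begin
  -1ℤ ^ suc (n + suc n)          ≡⟨ cong (λ m → -1ℤ ^ suc m) (ℕ.+-suc n n) ⟩
  -1ℤ * (-1ℤ * -1ℤ ^ (n + n))    ≡⟨ cong (λ z → -1ℤ * (-1ℤ * z)) (-1^[n+n]≡1 n) ⟩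
  1ℤ                             ∎
  where open ≡-Reasoning

even-or-odd : ∀ n → ∃[ m ] (n ≡ m + m ⊎ n ≡ suc (m + m))
even-or-odd zero = 0 , inj₁ refl
even-or-odd (suc n) with even-or-odd n
... | m , inj₁ n≡2m = m , inj₂ (cong suc n≡2m)
... | m , inj₂ n≡1+2m = suc m , inj₁ (cong suc (trans n≡1+2m (sym (ℕ.+-suc m m))))

module SymmetricResidue (p : ℕ) .{{_ : NonZero p}} (p≡1+2h : p ≡ suc (half p + half p)) where

  open Congruence p

  h : ℕ
  h = half p

  τ : ℤ
  τ = + t p

  h+h<p : h + h < p
  h+h<p = subst (h + h <_) (sym p≡1+2h) (ℕ.n<1+n (h + h))

  ≤h⇒<p : ∀ {y} → y ≤ h → y < p
  ≤h⇒<p y≤h = ℕ.≤-<-trans (ℕ.≤-trans y≤h (ℕ.m≤m+n h h)) h+h<p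

  tilde-cases : ∀ x → (tilde p x ≡ x % p × x % p ≤ h) ⊎ (tilde p x ≡ p ∸ x % p × h < x % p)
  tilde-cases x with h <ᵇ x % p in h<ᵇr
  ... | true = inj₂ (refl , ℕ.<ᵇ⇒< h (x % p) (subst T (sym h<ᵇr) _))
  ... | false = inj₁ (refl , ℕ.≮⇒≥ λ h<r → subst T h<ᵇr (ℕ.<⇒<ᵇ h<r))

  tilde≈± : ∀ x → + tilde p x ≈± + x
  tilde≈± x with tilde-cases x
  ... | inj₁ (tilde≡r , _) = inj₁ (subst (λ y → + y ≈ + x) (sym tilde≡r) (%ℕ-≈ (+ x)))
  ... | inj₂ (tilde≡p∸r , _) = inj₂ (subst (λ y → + y ≈ - + x) (sym tilde≡p∸r)
        (≈-trans (m+n≡p⇒m≈-n (ℕ.m∸n+n≡m (ℕ.<⇒≤ (m%n<n x p)))) (-‿cong (%ℕ-≈ (+ x)))))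

  tilde≤h : ∀ x → tilde p x ≤ h
  tilde≤h x with tilde-cases x
  ... | inj₁ (tilde≡r , r≤h) = subst (_≤ h) (sym tilde≡r) r≤h
  ... | inj₂ (tilde≡p∸r , h<r) = subst (_≤ h) (sym tilde≡p∸r) (begin
    p ∸ x % p      ≤⟨ ℕ.∸-monoʳ-≤ p h<r ⟩
    p ∸ suc h      ≡⟨ cong (_∸ suc h) p≡1+2h ⟩
    suc (h + h) ∸ suc h  ≡⟨ ℕ.m+n∸m≡n h h ⟩
    h              ∎)
    where open ℕ.≤-Reasoning

  tilde-positive : ∀ {x} → ¬ + x ≈ 0ℤ → 0 < tilde p x
  tilde-positive {x} x≉0 with tilde-cases x
  ... | inj₁ (tilde≡r , _) = subst (0 <_) (sym tilde≡r) (ℕ.n≢0⇒n>0 λ r≡0 →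
        x≉0 (≈-trans (≈-sym (%ℕ-≈ (+ x))) (≈-reflexive (cong +_ r≡0))))
  ... | inj₂ (tilde≡p∸r , _) = subst (0 <_) (sym tilde≡p∸r) (ℕ.m<n⇒0<n∸m (m%n<n x p))

  tilde-< : ∀ {x} → x < p → tilde p x ≡ x ⊎ tilde p x + x ≡ p
  tilde-< {x} x<p with tilde-cases x
  ... | inj₁ (tilde≡r , _) = inj₁ (trans tilde≡r (m<n⇒m%n≡m x<p))
  ... | inj₂ (tilde≡p∸r , _) =
    inj₂ (trans (cong (_+ x) (trans tilde≡p∸r (cong (p ∸_) (m<n⇒m%n≡m x<p))))
                (ℕ.m∸n+n≡m (ℕ.<⇒≤ x<p)))

  ≈±-injective : ∀ {y z} → 0 < y → y ≤ h → z ≤ h → + y ≈± + z → y ≡ z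
  ≈±-injective _ y≤h z≤h (inj₁ y≈z) = ≈-injective (≤h⇒<p y≤h) (≤h⇒<p z≤h) y≈z
  ≈±-injective {y} {z} 0<y y≤h z≤h (inj₂ y≈-z) = contradiction (m≈-n⇒m+n≈0 y≈-z)
    (positive⇒≉0 (ℕ.<-≤-trans 0<y (ℕ.m≤m+n y z)) (ℕ.≤-<-trans (ℕ.+-mono-≤ y≤h z≤h) h+h<p))

  tilde-unique : ∀ {x y} → 0 < y → y ≤ h → + y ≈± + x → tilde p x ≡ y
  tilde-unique {x} 0<y y≤h y≈±x =
    sym (≈±-injective 0<y y≤h (tilde≤h x) (≈±-trans y≈±x (≈±-sym (tilde≈± x))))

  tilde-cong : ∀ {x y} → ¬ + y ≈ 0ℤ → + x ≈± + y → tilde p x ≡ tilde p y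
  tilde-cong {x} {y} y≉0 x≈±y =
    tilde-unique (tilde-positive y≉0) (tilde≤h y) (≈±-trans (tilde≈± y) (≈±-sym x≈±y))

  reflected-sum : ∀ i j → i + suc j ≡ h → suc (h + j) + suc i ≡ p
  reflected-sum i j i+[1+j]≡h = begin
    suc (h + j) + suc i    ≡⟨ cong suc (ℕ.+-assoc h j (suc i)) ⟩
    suc (h + (j + suc i))  ≡⟨ cong (λ n → suc (h + n)) (trans (ℕ.+-comm j (suc i)) (sym (ℕ.+-suc i j))) ⟩
    suc (h + (i + suc j))  ≡⟨ cong (λ n → suc (h + n)) i+[1+j]≡h ⟩
    suc (h + h)            ≡⟨ p≡1+2h ⟨
    p                      ∎
    where open ≡-Reasoning

  -- Each factor h + j + 1 of (h + j + 1)! is ≈ -(i + 1), which extends i! to (i + 1)!.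
  factorial-reflection : ∀ i j → i + j ≡ h → + ((h + j) !) * + (i !) ≈ -1ℤ ^ j * (τ * τ)
  factorial-reflection i zero i+0≡h = ≈-reflexive (begin
    + ((h + 0) !) * + (i !)  ≡⟨ cong₂ (λ a b → + (a !) * + (b !))
                                   (ℕ.+-identityʳ h) (trans (sym (ℕ.+-identityʳ i)) i+0≡h) ⟩
    τ * τ                    ≡⟨ ℤ.*-identityˡ (τ * τ) ⟨
    1ℤ * (τ * τ)             ∎)
    where open ≡-Reasoning
  factorial-reflection i (suc j) i+[1+j]≡h = begin
    + ((h + suc j) !) * + (i !)                ≡⟨ cong (λ n → + (n !) * + (i !)) (ℕ.+-suc h j) ⟩
    + (suc (h + j) !) * + (i !)                ≡⟨ cong (_* + (i !)) (ℤ.pos-* (suc (h + j)) ((h + j) !)) ⟩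
    (+ suc (h + j) * + ((h + j) !)) * + (i !)  ≈⟨ *-cong (*-cong reflection (≈-refl {+ ((h + j) !)}))
                                                          (≈-refl {+ (i !)}) ⟩
    (- + suc i * + ((h + j) !)) * + (i !)      ≡⟨ rearrange (+ suc i) (+ ((h + j) !)) (+ (i !)) ⟩
    - (+ ((h + j) !) * (+ suc i * + (i !)))    ≡⟨ cong (λ z → - (+ ((h + j) !) * z)) (ℤ.pos-* (suc i) (i !)) ⟨
    - (+ ((h + j) !) * + (suc i !))            ≈⟨ -‿cong (factorial-reflection (suc i) j
                                                            (trans (sym (ℕ.+-suc i j)) i+[1+j]≡h)) ⟩
    - (-1ℤ ^ j * (τ * τ))                      ≡⟨ ℤ.neg-distribˡ-* (-1ℤ ^ j) (τ * τ) ⟩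
    - (-1ℤ ^ j) * (τ * τ)                      ≡⟨ cong (_* (τ * τ)) (ℤ.-1*i≡-i (-1ℤ ^ j)) ⟨
    -1ℤ ^ suc j * (τ * τ)                      ∎
    where
    open ≈-Reasoning
    rearrange : ∀ a b c → (- a * b) * c ≡ - (b * (a * c))
    rearrange = solve-∀
    reflection : + suc (h + j) ≈ - + suc i
    reflection = m+n≡p⇒m≈-n (reflected-sum i j i+[1+j]≡h)

module OneModFour (p : ℕ) .{{_ : NonZero p}} (prime : Prime p) (p≡1+2h : p ≡ suc (half p + half p))
                  (k : ℕ) (h≡k+k : half p ≡ k + k) where

  open Congruence p
  open PrimeModulus prime
  open SymmetricResidue p p≡1+2h

  τ²≈-1 : τ * τ ≈ -1ℤ
  τ²≈-1 = begin
    τ * τ              ≡⟨ ℤ.*-identityˡ (τ * τ) ⟨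
    1ℤ * (τ * τ)       ≡⟨ cong (_* (τ * τ)) (trans (cong (-1ℤ ^_) h≡k+k) (-1^[n+n]≡1 k)) ⟨
    -1ℤ ^ h * (τ * τ)  ≈⟨ factorial-reflection 0 h refl ⟨
    + ((h + h) !) * 1ℤ ≡⟨ ℤ.*-identityʳ (+ ((h + h) !)) ⟩
    + ((h + h) !)      ≡⟨ cong (λ n → + ((n ∸ 1) !)) p≡1+2h ⟨
    + ((p ∸ 1) !)      ≈⟨ wilson ⟩
    -1ℤ                ∎
    where open ≈-Reasoning

  τ*[τ*x]≈-x : ∀ x → τ * (τ * x) ≈ - x
  τ*[τ*x]≈-x x = begin
    τ * (τ * x)  ≡⟨ ℤ.*-assoc τ τ x ⟨
    (τ * τ) * x  ≈⟨ *-cong τ²≈-1 (≈-refl {x}) ⟩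
    -1ℤ * x      ≡⟨ ℤ.-1*i≡-i x ⟩
    - x          ∎
    where open ≈-Reasoning

  τ≉0 : ¬ τ ≈ 0ℤ
  τ≉0 τ≈0 = positive⇒≉0 ℕ.z<s 1<p (begin
    1ℤ         ≡⟨ ℤ.neg-involutive 1ℤ ⟨
    - -1ℤ      ≈⟨ -‿cong τ²≈-1 ⟨
    - (τ * τ)  ≈⟨ -‿cong (*-cong τ≈0 (≈-refl {τ})) ⟩
    0ℤ         ∎)
    where open ≈-Reasoning

  2≉0 : ¬ + 2 ≈ 0ℤ
  2≉0 = positive⇒≉0 ℕ.z<s (subst (2 <_) (sym p≡1+2h) (s≤s (ℕ.+-mono-≤ 1≤h 1≤h)))
    where
    1≤h : 1 ≤ h
    1≤h = ℕ.n≢0⇒n>0 λ h≡0 → ℕ.<⇒≢ 1<p (sym (trans p≡1+2h (cong (λ n → suc (n + n)) h≡0)))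

  bar≈± : ∀ a → + bar p a ≈± τ * + a
  bar≈± a = subst (+ bar p a ≈±_) (ℤ.pos-* (t p) a) (tilde≈± (t p ℕ.* a))

  bar≤h : ∀ a → bar p a ≤ h
  bar≤h a = tilde≤h (t p ℕ.* a)

  bar-positive : ∀ {a} → 0 < a → a ≤ h → 0 < bar p a
  bar-positive {a} 0<a a≤h = tilde-positive λ ta≈0 → [ τ≉0 , positive⇒≉0 0<a (≤h⇒<p a≤h) ]′
    (x*y≈0⇒x≈0∨y≈0 τ (+ a) (subst (_≈ 0ℤ) (ℤ.pos-* (t p) a) ta≈0))

  bar-unique : ∀ {a y} → 0 < y → y ≤ h → + y ≈± τ * + a → bar p a ≡ y
  bar-unique {a} {y} 0<y y≤h y≈±τa = tilde-unique 0<y y≤h (subst (+ y ≈±_) (sym (ℤ.pos-* (t p) a)) y≈±τa)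

  bar-involutive : ∀ {a} → 0 < a → a ≤ h → bar p (bar p a) ≡ a
  bar-involutive {a} 0<a a≤h =
    bar-unique 0<a a≤h (≈±-sym (≈±-trans (≈±-*-congˡ τ (bar≈± a)) (inj₂ (τ*[τ*x]≈-x (+ a)))))

  bar≢self : ∀ {a} → 0 < a → a ≤ h → bar p a ≢ a
  bar≢self {a} 0<a a≤h ā≡a = positive⇒≉0 (ℕ.<-≤-trans 0<a (ℕ.m≤m+n a a)) (≤h+h⇒<p (ℕ.+-mono-≤ a≤h a≤h))
    ([ id , id ]′ (≈±-sym 0≈±2a))
    where
    ≤h+h⇒<p : ∀ {y} → y ≤ h + h → y < p
    ≤h+h⇒<p y≤2h = ℕ.≤-<-trans y≤2h h+h<p
    0≈±2a : 0ℤ ≈± + (a + a)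
    0≈±2a = subst₂ _≈±_ (trans (cong (τ *_) (ℤ.+-inverseʳ (+ a))) (ℤ.*-zeroʳ τ)) (sym (ℤ.pos-+ a a))
      (*-difference τ τ²≈-1 {+ a} {+ a} (subst (λ y → + y ≈± τ * + a) ā≡a (bar≈± a)))

  difference∈V : ∀ {a} → InV p a → InV p (bar p a ∸ a) × bar p (bar p a ∸ a) ≡ tilde p (bar p a + a)
  difference∈V {a} ((0<a , a≤h) , a<ā) = ((ℕ.m<n⇒0<n∸m a<ā , b≤h) , b<b̄) , b̄≡tilde[ā+a]
    where
    ā = bar p a
    b = ā ∸ a
    b≤h : b ≤ h
    b≤h = ℕ.≤-trans (ℕ.m∸n≤m ā a) (bar≤h a)
    ā+a<p : ā + a < p
    ā+a<p = ℕ.≤-<-trans (ℕ.+-mono-≤ (bar≤h a) (ℕ.≤-trans (ℕ.<⇒≤ a<ā) (bar≤h a))) h+h<p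
    b̄≡tilde[ā+a] : bar p b ≡ tilde p (ā + a)
    b̄≡tilde[ā+a] = tilde-cong (positive⇒≉0 (ℕ.<-≤-trans 0<a (ℕ.m≤n+m a ā)) ā+a<p) (subst₂ _≈±_
      (trans (cong (τ *_) ([+m]-[+n]≡+[m∸n] (ℕ.<⇒≤ a<ā))) (sym (ℤ.pos-* (t p) b)))
      (sym (ℤ.pos-+ ā a))
      (*-difference τ τ²≈-1 {+ a} {+ ā} (bar≈± a)))
    b<b̄ : b < bar p b
    b<b̄ with tilde-< ā+a<p
    ... | inj₁ tilde≡ā+a = subst (b <_) (sym (trans b̄≡tilde[ā+a] tilde≡ā+a))
          (ℕ.≤-<-trans (ℕ.m∸n≤m ā a) (ℕ.m<m+n ā 0<a))
    ... | inj₂ tilde+ā+a≡p = ℕ.+-cancelʳ-< (ā + a) b (bar p b) (begin-strict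
          b + (ā + a)                  ≡⟨ cong (λ n → b + n) (ℕ.+-comm ā a) ⟩
          b + (a + ā)                  ≡⟨ ℕ.+-assoc b a ā ⟨
          (b + a) + ā                  ≡⟨ cong (_+ ā) (ℕ.m∸n+n≡m (ℕ.<⇒≤ a<ā)) ⟩
          ā + ā                        <⟨ ℕ.≤-<-trans (ℕ.+-mono-≤ (bar≤h a) (bar≤h a)) h+h<p ⟩
          p                            ≡⟨ tilde+ā+a≡p ⟨
          tilde p (ā + a) + (ā + a)    ≡⟨ cong (_+ (ā + a)) b̄≡tilde[ā+a] ⟨
          bar p b + (ā + a)            ∎)
      where open ℕ.≤-Reasoning

  difference-preimage : ∀ {a b} → 0 < a → 0 < b → a + b ≤ h → + (b + (a + a)) ≈± τ * + b →
                        InV p a × b ≡ bar p a ∸ a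
  difference-preimage {a} {b} 0<a 0<b a+b≤h b+2a≈±τb =
    ((0<a , ℕ.≤-trans (ℕ.m≤m+n a b) a+b≤h) , subst (a <_) (sym ā≡a+b) (ℕ.m<m+n a 0<b)) ,
    sym (trans (cong (_∸ a) ā≡a+b) (ℕ.m+n∸m≡n a b))
    where
    ā≡a+b : bar p a ≡ a + b
    ā≡a+b = bar-unique (ℕ.<-≤-trans 0<a (ℕ.m≤m+n a b)) a+b≤h
      (subst (_≈± τ * + a) (sym (ℤ.pos-+ a b)) (*-halving τ τ²≈-1 2≉0 {+ a} {+ b}
        (subst (_≈± τ * + b) (trans (ℤ.pos-+ b (a + a)) (cong (λ z → + b ℤ.+ z) (ℤ.pos-+ a a))) b+2a≈±τb)))

  -- a is chosen with b + 2a ≡ b̄ or b + 2a + b̄ ≡ p, according to the parity of b̄ - b.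
  difference-surjective : ∀ {b} → InV p b → ∃[ a ] InV p a × b ≡ bar p a ∸ a
  difference-surjective {b} ((0<b , b≤h) , b<b̄) with even-or-odd (bar p b ∸ b)
  ... | m , inj₁ b̄∸b≡m+m =
    m , difference-preimage 0<m 0<b m+b≤h (subst (λ c → + c ≈± τ * + b) b̄≡b+2m (bar≈± b))
    where
    b̄≡b+2m : bar p b ≡ b + (m + m)
    b̄≡b+2m = trans (sym (ℕ.m+[n∸m]≡n (ℕ.<⇒≤ b<b̄))) (cong (λ n → b + n) b̄∸b≡m+m)
    0<m : 0 < m
    0<m = ℕ.n≢0⇒n>0 λ m≡0 → ℕ.<⇒≢ b<b̄
      (sym (trans b̄≡b+2m (trans (cong (λ n → b + (n + n)) m≡0) (ℕ.+-identityʳ b))))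
    m+b≤h : m + b ≤ h
    m+b≤h = ℕ.≤-trans (ℕ.+-monoˡ-≤ b (ℕ.m≤m+n m m))
      (subst (_≤ h) (trans b̄≡b+2m (ℕ.+-comm b (m + m))) (bar≤h b))
  ... | m , inj₂ b̄∸b≡1+2m =
    a , difference-preimage 0<a 0<b a+b≤h (≈±-trans (inj₂ (m+n≡p⇒m≈-n b+2a+b̄≡p)) (bar≈± b))
    where
    b̄≡b+1+2m : bar p b ≡ b + suc (m + m)
    b̄≡b+1+2m = trans (sym (ℕ.m+[n∸m]≡n (ℕ.<⇒≤ b<b̄))) (cong (λ n → b + n) b̄∸b≡1+2m)
    b+m<h : b + m < h
    b+m<h = ℕ.<-≤-trans (subst (b + m <_) (sym b̄≡b+1+2m) (ℕ.+-monoʳ-< b (s≤s (ℕ.m≤m+n m m)))) (bar≤h b)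
    a = h ∸ (b + m)
    a+[b+m]≡h : a + (b + m) ≡ h
    a+[b+m]≡h = ℕ.m∸n+n≡m (ℕ.<⇒≤ b+m<h)
    0<a : 0 < a
    0<a = ℕ.m<n⇒0<n∸m b+m<h
    a+b≤h : a + b ≤ h
    a+b≤h = subst (a + b ≤_) a+[b+m]≡h (ℕ.+-monoʳ-≤ a (ℕ.m≤m+n b m))
    regroup : ∀ a b m → (b + (a + a)) + (b + suc (m + m)) ≡ suc ((a + (b + m)) + (a + (b + m)))
    regroup = ℕ-Solver.solve-∀
    b+2a+b̄≡p : (b + (a + a)) + bar p b ≡ p
    b+2a+b̄≡p = begin
      (b + (a + a)) + bar p b                  ≡⟨ cong (λ n → (b + (a + a)) + n) b̄≡b+1+2m ⟩
      (b + (a + a)) + (b + suc (m + m))        ≡⟨ regroup a b m ⟩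
      suc ((a + (b + m)) + (a + (b + m)))      ≡⟨ cong (λ n → suc (n + n)) a+[b+m]≡h ⟩
      suc (h + h)                              ≡⟨ p≡1+2h ⟨
      p                                        ∎
      where open ≡-Reasoning

  bar∉V : ∀ {b} → InV p b → ¬ InV p (bar p b)
  bar∉V {b} ((0<b , b≤h) , b<b̄) (_ , b̄<b̄̄) =
    ℕ.<-asym b<b̄ (subst (bar p b <_) (bar-involutive 0<b b≤h) b̄<b̄̄)

  bar∈V : ∀ {y} → 0 < y → y ≤ h → ¬ InV p y → InV p (bar p y)
  bar∈V {y} 0<y y≤h y∉V =
    (bar-positive 0<y y≤h , bar≤h y) , subst (bar p y <_) (sym (bar-involutive 0<y y≤h)) ȳ<y
    where
    ȳ<y : bar p y < y
    ȳ<y = ℕ.≤∧≢⇒< (ℕ.≮⇒≥ λ y<ȳ → y∉V ((0<y , y≤h) , y<ȳ)) (bar≢self 0<y y≤h)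

  ∈V⇔difference : ∀ y → InV p y ⇔ (∃[ a ] (InV p a × y ≡ bar p a ∸ a))
  ∈V⇔difference y = mk⇔ difference-surjective
    λ (a , a∈V , y≡ā∸a) → subst (InV p) (sym y≡ā∸a) (proj₁ (difference∈V a∈V))

  ∉V⇔tilde-sum : ∀ y → ((1 ≤ y × y ≤ h) × ¬ InV p y) ⇔ (∃[ a ] (InV p a × y ≡ tilde p (bar p a + a)))
  ∉V⇔tilde-sum y = mk⇔ to from
    where
    to : (1 ≤ y × y ≤ h) × ¬ InV p y → ∃[ a ] (InV p a × y ≡ tilde p (bar p a + a))
    to ((0<y , y≤h) , y∉V) =
      let a , a∈V , ȳ≡ā∸a = difference-surjective (bar∈V 0<y y≤h y∉V) in
      a , a∈V , (begin
        y                    ≡⟨ bar-involutive 0<y y≤h ⟨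
        bar p (bar p y)      ≡⟨ cong (bar p) ȳ≡ā∸a ⟩
        bar p (bar p a ∸ a)  ≡⟨ proj₂ (difference∈V a∈V) ⟩
        tilde p (bar p a + a) ∎)
      where open ≡-Reasoning
    from : ∃[ a ] (InV p a × y ≡ tilde p (bar p a + a)) → (1 ≤ y × y ≤ h) × ¬ InV p y
    from (a , a∈V , y≡tilde) =
      let b∈V , b̄≡tilde = difference∈V a∈V ; (0<b , b≤h) , _ = b∈V in
      subst (λ z → (1 ≤ z × z ≤ h) × ¬ InV p z) (sym (trans y≡tilde (sym b̄≡tilde)))
        ((bar-positive 0<b b≤h , bar≤h (bar p a ∸ a)) , bar∉V b∈V)

module _ (p : ℕ) .{{_ : NonZero p}} (p%4≡1 : p % 4 ≡ 1) where

  private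
    k = p ℕ./ 4
    4k≡2k+2k : ∀ k → k ℕ.* 4 ≡ (k + k) + (k + k)
    4k≡2k+2k = ℕ-Solver.solve-∀
    [k+k]*2≡2k+2k : ∀ k → (k + k) ℕ.* 2 ≡ (k + k) + (k + k)
    [k+k]*2≡2k+2k = ℕ-Solver.solve-∀
    p≡1+4k : p ≡ suc ((k + k) + (k + k))
    p≡1+4k = trans (m≡m%n+[m/n]*n p 4) (cong₂ _+_ p%4≡1 (4k≡2k+2k k))

  half≡p/4+p/4 : half p ≡ p ℕ./ 4 + p ℕ./ 4
  half≡p/4+p/4 = begin
    (p ∸ 1) ℕ./ 2                        ≡⟨ cong (λ n → (n ∸ 1) ℕ./ 2) p≡1+4k ⟩
    ((k + k) + (k + k)) ℕ./ 2            ≡⟨ cong (ℕ._/ 2) ([k+k]*2≡2k+2k k) ⟨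
    ((k + k) ℕ.* 2) ℕ./ 2                ≡⟨ m*n/n≡m (k + k) 2 ⟩
    k + k                                ∎
    where open ≡-Reasoning

  p≡1+2half : p ≡ suc (half p + half p)
  p≡1+2half = trans p≡1+4k (cong (λ n → suc (n + n)) (sym half≡p/4+p/4))

theorem2p4 : (p : ℕ) → .{{_ : NonZero p}} → Prime p → p % 4 ≡ 1 →
    ((a : ℕ) → InV p a →
      InV p (bar p a ∸ a) × bar p (bar p a ∸ a) ≡ tilde p (bar p a + a))
    × ((y : ℕ) → InV p y ⇔ (∃[ a ] (InV p a × y ≡ bar p a ∸ a)))
    × ((y : ℕ) → ((1 ≤ y × y ≤ half p) × ¬ InV p y) ⇔ (∃[ a ] (InV p a × y ≡ tilde p (bar p a + a))))
theorem2p4 p p-prime p%4≡1 = (λ a → difference∈V {a}) , ∈V⇔difference , ∉V⇔tilde-sum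
  where open OneModFour p p-prime (p≡1+2half p p%4≡1) (p ℕ./ 4) (half≡p/4+p/4 p p%4≡1)
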